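{- Let $r$ be a positive integer and let $F:\mathbf{Set}^r\to\mathbf{Set}$ be a decomposable $r$-sort species with composition operator $\eta$. Then $F^{(1)}_\eta[\Omega]=F_\eta[\Omega]$ for every object $\Omega$ of $\mathbf{Set}^r$; that is, the functors $F^{(1)}_\eta$ and $F_\eta$ (both acting on morphisms by restriction of $F$) coincide.
   Context: $\mathbf{Set}$ is the category of finite sets and bijections. Objects of $\mathbf{Set}^r$ are $r$-tuples of finite sets; set operations are componentwise, and $\boldsymbol\emptyset=(\emptyset,\dots,\emptyset)$. An $r$-sort species is a functor $F:\mathbf{Set}^r\to\mathbf{Set}$. A composition operator for $F$ is a family of injective maps $\eta_{(\Omega_1,\Omega_2)}:F[\Omega_1]\times F[\Omega_2]\to F[\Omega_1\amalg\Omega_2]$, one for each disjoint pair, with the following two properties. - Naturality: $\eta_{(\tilde\Omega_1,\tilde\Omega_2)}\circ(F[f_1]\times F[f_2])=F[f_1\amalg f_2]\circ\eta_{(\Omega_1,\Omega_2)}$ for tuples of bijections $f_i:\Omega_i\to\tilde\Omega_i$. - Axiom (D1): whenever $\Omega_1\amalg\Omega_2=\Omega=\tilde\Omega_1\amalg\tilde\Omega_2$, \[ \eta(F[\Omega_1]\times F[\Omega_2])\cap\eta(F[\tilde\Omega_1]\times F[\tilde\Omega_2])=\eta(\eta(F[\Omega_{11}]\times F[\Omega_{12}])\times\eta(F[\Omega_{21}]\times F[\Omega_{22}])), \] where $\Omega_{ij}=\Omega_i\cap\tilde\Omega_j$. $\eta(A\times B)$ denotes the image under the relevant $\eta$-map.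 $F$ is decomposable if some $F[\Omega]\ne\emptyset$ and $F$ admits a composition operator. Define $F_\eta[\boldsymbol\emptyset]=\emptyset$ and, for $\Omega\neq\boldsymbol\emptyset$, $F_\eta[\Omega]=F[\Omega]-\bigcup\eta(F[I]\times F[J])$, the union over disjoint pairs with $I\amalg J=\Omega$ and $I\ne\boldsymbol\emptyset\ne J$. Define $F^{(0)}_\eta[\boldsymbol\emptyset]=F[\boldsymbol\emptyset]$ and $F^{(0)}_\eta[\Omega]=\emptyset$ otherwise. Define $F^{(1)}_\eta[\Omega]=\bigcup_{\Omega_1\subseteq\Omega}\eta(F_\eta[\Omega_1]\times F^{(0)}_\eta[\Omega-\Omega_1])$. -}

module Defs where

open import Data.Bool using (Bool; true; false; _∧_; _∨_; not; T)
open import Data.Nat using (ℕ; zero; suc)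
open import Data.Fin using (Fin)
open import Data.List using (List; []; _∷_; foldr; map)
open import Data.Vec using (Vec; []; _∷_; lookup; replicate; zipWith)
open import Data.Product using (Σ; Σ-syntax; _×_; _,_; proj₁; proj₂)
open import Relation.Binary.PropositionalEquality using (_≡_; subst)
open import Relation.Nullary using (¬_)
open import Function.Bundles using (_⤖_; _↔_; Bijection)
open import Function.Construct.Composition using (_⤖-∘_)
open import Function.Construct.Identity using (⤖-id)

-- Finite sets (of natural numbers), in a canonical representation, so
-- that equality of finite sets is propositional equality.
-- A nonempty finite set is its characteristic bit string with the last
-- (highest) bit equal to true.

data Bits⁺ : Set where
  [1] : Bits⁺
  _∷_ : Bool → Bits⁺ → Bits⁺

data FinSet : Set where
  ∅ˢ  : FinSet
  nz : Bits⁺ → FinSet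

bits⁺ : Bits⁺ → List Bool
bits⁺ [1]      = true ∷ []
bits⁺ (b ∷ bs) = b ∷ bits⁺ bs

toBits : FinSet → List Bool
toBits ∅ˢ     = []
toBits (nz s) = bits⁺ s

consˢ : Bool → FinSet → FinSet
consˢ false ∅ˢ     = ∅ˢ
consˢ true  ∅ˢ     = nz [1]
consˢ b     (nz s) = nz (b ∷ s)

fromBits : List Bool → FinSet
fromBits = foldr consˢ ∅ˢ

zipPad : (Bool → Bool → Bool) → List Bool → List Bool → List Bool
zipPad f []       ys       = map (f false) ys
zipPad f (x ∷ xs) []       = map (λ b → f b false) (x ∷ xs)
zipPad f (x ∷ xs) (y ∷ ys) = f x y ∷ zipPad f xs ys

binopˢ : (Bool → Bool → Bool) → FinSet → FinSet → FinSet
binopˢ f s t = fromBits (zipPad f (toBits s) (toBits t))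

_∪ˢ_ _∩ˢ_ _∖ˢ_ : FinSet → FinSet → FinSet
_∪ˢ_ = binopˢ _∨_
_∩ˢ_ = binopˢ _∧_
_∖ˢ_ = binopˢ (λ a b → a ∧ not b)

memberᵇ : ℕ → List Bool → Bool
memberᵇ _       []       = false
memberᵇ zero    (b ∷ _)  = b
memberᵇ (suc n) (_ ∷ bs) = memberᵇ n bs

_∈ˢ_ : ℕ → FinSet → Set
x ∈ˢ s = T (memberᵇ x (toBits s))

isEmptyᵇ : FinSet → Bool
isEmptyᵇ ∅ˢ     = true
isEmptyᵇ (nz _) = false

Elem : FinSet → Set
Elem s = Σ ℕ (λ x → x ∈ˢ s)

Obj : ℕ → Set
Obj r = Vec FinSet r

module _ {r : ℕ} where

  ∅ₒ : Obj r
  ∅ₒ = replicate r ∅ˢ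

  _∪_ _∩_ _-_ : Obj r → Obj r → Obj r
  _∪_ = zipWith _∪ˢ_
  _∩_ = zipWith _∩ˢ_
  _-_ = zipWith _∖ˢ_

  _⊆_ : Obj r → Obj r → Set
  A ⊆ B = ∀ (i : Fin r) (x : ℕ) → x ∈ˢ lookup A i → x ∈ˢ lookup B i

  record Hom (A B : Obj r) : Set where
    constructor hom
    field
      bij : (i : Fin r) → Elem (lookup A i) ⤖ Elem (lookup B i)

  idH : (A : Obj r) → Hom A A
  idH A = hom (λ i → ⤖-id _)

  _∘H_ : {A B C : Obj r} → Hom B C → Hom A B → Hom A C
  hom g ∘H hom f = hom (λ i → g i ⤖-∘ f i)

  app : {A B : Obj r} → Hom A B → (i : Fin r) → Elem (lookup A i) → Elem (lookup B i)
  app (hom f) i = Bijection.to (f i)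

disjᵇ : {r : ℕ} → Obj r → Obj r → Bool
disjᵇ []       []       = true
disjᵇ (s ∷ ss) (t ∷ ts) = isEmptyᵇ (s ∩ˢ t) ∧ disjᵇ ss ts

Disjoint : {r : ℕ} → Obj r → Obj r → Set
Disjoint A B = T (disjᵇ A B)

-- r-sort species  F : Set^r → Set  (values are finite sets, morphisms
-- are sent to maps; functoriality makes them bijections).

record Species (r : ℕ) : Set₁ where
  field
    F₀     : Obj r → Set
    finite : ∀ A → Σ[ n ∈ ℕ ] (F₀ A ↔ Fin n)
    F₁     : {A B : Obj r} → Hom A B → F₀ A → F₀ B
    F-id   : ∀ {A} (x : F₀ A) → F₁ (idH A) x ≡ x
    F-∘    : ∀ {A B C} (g : Hom B C) (f : Hom A B) (x : F₀ A) →
             F₁ (g ∘H f) x ≡ F₁ g (F₁ f x)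
    -- morphisms are equal when they are equal as maps
    F-cong : ∀ {A B} (f f′ : Hom A B) →
             (∀ i e → app f i e ≡ app f′ i e) → ∀ x → F₁ f x ≡ F₁ f′ x

module _ {r : ℕ} (F : Species r) where
  open Species F

  IsCoprodMap : {A₁ A₂ B₁ B₂ : Obj r} → Hom A₁ B₁ → Hom A₂ B₂ →
                Hom (A₁ ∪ A₂) (B₁ ∪ B₂) → Set
  IsCoprodMap {A₁} {A₂} f₁ f₂ g =
    ∀ (i : Fin r) (e : Elem (lookup (A₁ ∪ A₂) i)) →
      (∀ (h : proj₁ e ∈ˢ lookup A₁ i) → proj₁ (app g i e) ≡ proj₁ (app f₁ i (proj₁ e , h)))
    × (∀ (h : proj₁ e ∈ˢ lookup A₂ i) → proj₁ (app g i e) ≡ proj₁ (app f₂ i (proj₁ e , h)))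

  EtaFamily : Set
  EtaFamily = ∀ (A B : Obj r) → Disjoint A B → F₀ A → F₀ B → F₀ (A ∪ B)

  module _ (η : EtaFamily) where

    IsEta : (A B C : Obj r) → F₀ A → F₀ B → F₀ C → Set
    IsEta A B C a b x =
      Σ[ d ∈ Disjoint A B ] Σ[ e ∈ A ∪ B ≡ C ] subst F₀ e (η A B d a b) ≡ x

    InImg : (A B C : Obj r) → F₀ C → Set
    InImg A B C x = Σ[ a ∈ F₀ A ] Σ[ b ∈ F₀ B ] IsEta A B C a b x

  record CompositionOperator : Set where
    field
      η         : EtaFamily
      injective : ∀ A B (d : Disjoint A B) a a′ b b′ →
                  η A B d a b ≡ η A B d a′ b′ → (a ≡ a′) × (b ≡ b′)
      natural   : ∀ {A₁ A₂ B₁ B₂} (d : Disjoint A₁ A₂) (d̃ : Disjoint B₁ B₂)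
                  (f₁ : Hom A₁ B₁) (f₂ : Hom A₂ B₂) (g : Hom (A₁ ∪ A₂) (B₁ ∪ B₂)) →
                  IsCoprodMap f₁ f₂ g → ∀ a b →
                  η B₁ B₂ d̃ (F₁ f₁ a) (F₁ f₂ b) ≡ F₁ g (η A₁ A₂ d a b)
      D1        : ∀ (Ω Ω₁ Ω₂ Ω̃₁ Ω̃₂ : Obj r) →
                  Disjoint Ω₁ Ω₂ → Ω₁ ∪ Ω₂ ≡ Ω →
                  Disjoint Ω̃₁ Ω̃₂ → Ω̃₁ ∪ Ω̃₂ ≡ Ω →
                  ∀ (x : F₀ Ω) →
                  ((InImg η Ω₁ Ω₂ Ω x × InImg η Ω̃₁ Ω̃₂ Ω x) →
                     Σ[ y ∈ F₀ Ω₁ ] Σ[ z ∈ F₀ Ω₂ ]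
                       InImg η (Ω₁ ∩ Ω̃₁) (Ω₁ ∩ Ω̃₂) Ω₁ y
                     × InImg η (Ω₂ ∩ Ω̃₁) (Ω₂ ∩ Ω̃₂) Ω₂ z
                     × IsEta η Ω₁ Ω₂ Ω y z x)
                × ((Σ[ y ∈ F₀ Ω₁ ] Σ[ z ∈ F₀ Ω₂ ]
                       InImg η (Ω₁ ∩ Ω̃₁) (Ω₁ ∩ Ω̃₂) Ω₁ y
                     × InImg η (Ω₂ ∩ Ω̃₁) (Ω₂ ∩ Ω̃₂) Ω₂ z
                     × IsEta η Ω₁ Ω₂ Ω y z x) →
                   (InImg η Ω₁ Ω₂ Ω x × InImg η Ω̃₁ Ω̃₂ Ω x))

  Decomposable : Set
  Decomposable = (Σ[ A ∈ Obj r ] F₀ A) × CompositionOperator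

  module _ (η : EtaFamily) where

    InFη : (Ω : Obj r) → F₀ Ω → Set
    InFη Ω x = ¬ (Ω ≡ ∅ₒ) ×
               ¬ (Σ[ I ∈ Obj r ] Σ[ J ∈ Obj r ]
                    ¬ (I ≡ ∅ₒ) × ¬ (J ≡ ∅ₒ) × InImg η I J Ω x)

    InFη⁰ : (Ω : Obj r) → F₀ Ω → Set
    InFη⁰ Ω x = Ω ≡ ∅ₒ

    InFη¹ : (Ω : Obj r) → F₀ Ω → Set
    InFη¹ Ω x = Σ[ Ω₁ ∈ Obj r ] (Ω₁ ⊆ Ω) ×
                  (Σ[ a ∈ F₀ Ω₁ ] Σ[ b ∈ F₀ (Ω - Ω₁) ]
                     InFη Ω₁ a × InFη⁰ (Ω - Ω₁) b × IsEta η Ω₁ (Ω - Ω₁) Ω a b x)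

module Submission where

-- Write a ⋆ b for η(a, b).  Two consequences of axiom (D1) drive the proof.
-- Restriction: if x = a ⋆ b along Ω₁ ∐ Ω₂ = Ω and x ∈ η(F[I] × F[J]) for
-- another splitting I ∐ J = Ω, then a ∈ η(F[Ω₁ ∩ I] × F[Ω₁ ∩ J]).
-- Extension: conversely, if a and b split along the traces of I and J,
-- then x = a ⋆ b lies in η(F[I] × F[J]).
--
-- (⊆) An element of F^(1)_η[Ω] is x = a ⋆ b with b ∈ F[∅] and a
-- irreducible in F[Ω]; a splitting of x would restrict to one of a.
-- (⊇) Decomposability gives some a₀ ∈ F[A]; gluing a₀ to its transport to
-- a disjoint copy of A and restricting produces an element e ∈ F[∅], and
-- then u = e ⋆ e ∈ F[∅] splits along every pair.  Since η is injective,
-- a ↦ a ⋆ u is an injective self-map of the finite set F[Ω], hence onto;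
-- so x = a ⋆ u, and a splitting of a would extend to one of x.

open import Defs
open import Data.Nat using (ℕ; _<_)
open import Data.Product using (Σ-syntax)
open import Function.Bundles using (_⇔_)

open import Data.Nat using (zero; suc; _≤_; z≤n; s≤s)
open import Data.Nat.Properties using (1+n≰n; <⇒≱)
open import Data.Bool using (Bool; true; false; _∧_; _∨_; not)
open import Data.Bool.Properties
  using (∨-identityʳ; ∨-comm; ∧-comm; ∧-zeroʳ; ∧-inverseʳ; ∧-abs-∨; T-irrelevant)
open import Data.Unit using (tt)
open import Data.Fin using (Fin; punchOut)
import Data.Fin as Fin
open import Data.Fin.Properties using (punchOut-injective; injective⇒≤; any?; _≟_)
open import Data.List using ([]; _∷_; map; length)
open import Data.Vec using ([]; _∷_; lookup; zipWith; head; tail)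
import Data.Vec as Vec
open import Data.Vec.Properties using (lookup-zipWith; lookup-replicate; lookup-map)
open import Data.Product using (Σ; _×_; _,_; proj₁; proj₂)
open import Relation.Binary.PropositionalEquality
open import Relation.Nullary using (¬_; yes; no; contradiction)
open import Function.Base using (_∘_)
open import Function.Definitions using (Injective)
open import Function.Bundles using (mk⇔; _↔_; Inverse; mk↔ₛ′; _⤖_)
open import Function.Construct.Composition using (_↔-∘_)
open import Function.Construct.Identity using (↔-id)
open import Function.Properties.Inverse using (↔⇒⤖)

member-[] : ∀ n → memberᵇ n [] ≡ false
member-[] zero    = refl
member-[] (suc n) = refl

-- consˢ only normalises away a trailing empty tail; membership is unaffected.
member-consˢ : ∀ n b s → memberᵇ n (toBits (consˢ b s)) ≡ memberᵇ n (b ∷ toBits s)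
member-consˢ zero    false ∅ˢ     = refl
member-consˢ (suc n) false ∅ˢ     = sym (member-[] n)
member-consˢ n       true  ∅ˢ     = refl
member-consˢ n       false (nz s) = refl
member-consˢ n       true  (nz s) = refl

member-fromBits : ∀ n l → memberᵇ n (toBits (fromBits l)) ≡ memberᵇ n l
member-fromBits n       []      = refl
member-fromBits zero    (b ∷ l) = member-consˢ zero b (fromBits l)
member-fromBits (suc n) (b ∷ l) =
  trans (member-consˢ (suc n) b (fromBits l)) (member-fromBits n l)

member-map : ∀ (g : Bool → Bool) → g false ≡ false →
             ∀ n l → memberᵇ n (map g l) ≡ g (memberᵇ n l)
member-map g g-false n       []      =
  trans (member-[] n) (trans (sym g-false) (cong g (sym (member-[] n))))
member-map g g-false zero    (b ∷ l) = refl
member-map g g-false (suc n) (b ∷ l) = member-map g g-false n l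

member-zipPad : ∀ f → f false false ≡ false → ∀ n l m →
                memberᵇ n (zipPad f l m) ≡ f (memberᵇ n l) (memberᵇ n m)
member-zipPad f f-false n []       m        =
  trans (member-map (f false) f-false n m)
        (cong (λ b → f b (memberᵇ n m)) (sym (member-[] n)))
member-zipPad f f-false n (b ∷ l)  []       =
  trans (member-map (λ a → f a false) f-false n (b ∷ l))
        (cong (f (memberᵇ n (b ∷ l))) (sym (member-[] n)))
member-zipPad f f-false zero    (b ∷ l) (c ∷ m) = refl
member-zipPad f f-false (suc n) (b ∷ l) (c ∷ m) = member-zipPad f f-false n l m

member-binop : ∀ f → f false false ≡ false → ∀ s t n →
               memberᵇ n (toBits (binopˢ f s t)) ≡ f (memberᵇ n (toBits s)) (memberᵇ n (toBits t))
member-binop f f-false s t n =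
  trans (member-fromBits n (zipPad f (toBits s) (toBits t)))
        (member-zipPad f f-false n (toBits s) (toBits t))

bits⁺-inhabited : ∀ bs → Σ ℕ (λ n → memberᵇ n (bits⁺ bs) ≡ true)
bits⁺-inhabited [1]      = zero , refl
bits⁺-inhabited (b ∷ bs) = suc (proj₁ (bits⁺-inhabited bs)) , proj₂ (bits⁺-inhabited bs)

bits⁺-ext : ∀ bs cs → (∀ n → memberᵇ n (bits⁺ bs) ≡ memberᵇ n (bits⁺ cs)) → bs ≡ cs
bits⁺-ext [1]      [1]      same = refl
bits⁺-ext [1]      (c ∷ cs) same with n , member ← bits⁺-inhabited cs
  with () ← trans (trans (sym (member-[] n)) (same (suc n))) member
bits⁺-ext (b ∷ bs) [1]      same with n , member ← bits⁺-inhabited bs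
  with () ← trans (trans (sym (member-[] n)) (sym (same (suc n)))) member
bits⁺-ext (b ∷ bs) (c ∷ cs) same =
  cong₂ _∷_ (same zero) (bits⁺-ext bs cs (same ∘ suc))

finSet-ext : ∀ s t → (∀ n → memberᵇ n (toBits s) ≡ memberᵇ n (toBits t)) → s ≡ t
finSet-ext ∅ˢ     ∅ˢ     same = refl
finSet-ext ∅ˢ     (nz t) same with n , member ← bits⁺-inhabited t
  with () ← trans (trans (sym (member-[] n)) (same n)) member
finSet-ext (nz s) ∅ˢ     same with n , member ← bits⁺-inhabited s
  with () ← trans (trans (sym (member-[] n)) (sym (same n))) member
finSet-ext (nz s) (nz t) same = cong nz (bits⁺-ext s t same)

memᵒ : ∀ {r} → Obj r → Fin r → ℕ → Bool
memᵒ A i n = memberᵇ n (toBits (lookup A i))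

obj-ext : ∀ {r} (A B : Obj r) → (∀ i n → memᵒ A i n ≡ memᵒ B i n) → A ≡ B
obj-ext []      []      same = refl
obj-ext (s ∷ A) (t ∷ B) same =
  cong₂ _∷_ (finSet-ext s t (same Fin.zero)) (obj-ext A B (same ∘ Fin.suc))

module _ {r : ℕ} where

  memᵒ-componentwise : ∀ f → f false false ≡ false → ∀ (A B : Obj r) i n →
                       memᵒ (zipWith (binopˢ f) A B) i n ≡ f (memᵒ A i n) (memᵒ B i n)
  memᵒ-componentwise f f-false A B i n rewrite lookup-zipWith (binopˢ f) i A B =
    member-binop f f-false (lookup A i) (lookup B i) n

  memᵒ-∪ : ∀ (A B : Obj r) i n → memᵒ (A ∪ B) i n ≡ (memᵒ A i n ∨ memᵒ B i n)
  memᵒ-∪ = memᵒ-componentwise _∨_ refl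

  memᵒ-∩ : ∀ (A B : Obj r) i n → memᵒ (A ∩ B) i n ≡ (memᵒ A i n ∧ memᵒ B i n)
  memᵒ-∩ = memᵒ-componentwise _∧_ refl

  memᵒ-∖ : ∀ (A B : Obj r) i n → memᵒ (A - B) i n ≡ (memᵒ A i n ∧ not (memᵒ B i n))
  memᵒ-∖ = memᵒ-componentwise (λ a b → a ∧ not b) refl

  memᵒ-∅ : ∀ i n → memᵒ (∅ₒ {r}) i n ≡ false
  memᵒ-∅ i n rewrite lookup-replicate i ∅ˢ = member-[] n

  ∪-identityʳ : ∀ (A : Obj r) → A ∪ ∅ₒ ≡ A
  ∪-identityʳ A = obj-ext _ _ λ i n → begin
    memᵒ (A ∪ ∅ₒ) i n        ≡⟨ memᵒ-∪ A ∅ₒ i n ⟩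
    memᵒ A i n ∨ memᵒ ∅ₒ i n ≡⟨ cong (memᵒ A i n ∨_) (memᵒ-∅ i n) ⟩
    memᵒ A i n ∨ false       ≡⟨ ∨-identityʳ _ ⟩
    memᵒ A i n               ∎
    where open ≡-Reasoning

  ∩-zeroʳ : ∀ (A : Obj r) → A ∩ ∅ₒ ≡ ∅ₒ
  ∩-zeroʳ A = obj-ext _ _ λ i n → begin
    memᵒ (A ∩ ∅ₒ) i n        ≡⟨ memᵒ-∩ A ∅ₒ i n ⟩
    memᵒ A i n ∧ memᵒ ∅ₒ i n ≡⟨ cong (memᵒ A i n ∧_) (memᵒ-∅ i n) ⟩
    memᵒ A i n ∧ false       ≡⟨ ∧-zeroʳ _ ⟩
    false                    ≡⟨ memᵒ-∅ i n ⟨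
    memᵒ ∅ₒ i n              ∎
    where open ≡-Reasoning

  ∩-zeroˡ : ∀ (A : Obj r) → ∅ₒ ∩ A ≡ ∅ₒ
  ∩-zeroˡ A = obj-ext _ _ λ i n → begin
    memᵒ (∅ₒ ∩ A) i n        ≡⟨ memᵒ-∩ ∅ₒ A i n ⟩
    memᵒ ∅ₒ i n ∧ memᵒ A i n ≡⟨ cong (_∧ memᵒ A i n) (memᵒ-∅ i n) ⟩
    false                    ≡⟨ memᵒ-∅ i n ⟨
    memᵒ ∅ₒ i n              ∎
    where open ≡-Reasoning

  ∖-self : ∀ (A : Obj r) → A - A ≡ ∅ₒ
  ∖-self A = obj-ext _ _ λ i n → begin
    memᵒ (A - A) i n               ≡⟨ memᵒ-∖ A A i n ⟩
    memᵒ A i n ∧ not (memᵒ A i n)  ≡⟨ ∧-inverseʳ (memᵒ A i n) ⟩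
    false                          ≡⟨ memᵒ-∅ i n ⟨
    memᵒ ∅ₒ i n                    ∎
    where open ≡-Reasoning

  ∩-absorbˡ : ∀ (I J : Obj r) → (I ∪ J) ∩ I ≡ I
  ∩-absorbˡ I J = obj-ext _ _ λ i n → begin
    memᵒ ((I ∪ J) ∩ I) i n                   ≡⟨ memᵒ-∩ (I ∪ J) I i n ⟩
    memᵒ (I ∪ J) i n ∧ memᵒ I i n            ≡⟨ cong (_∧ memᵒ I i n) (memᵒ-∪ I J i n) ⟩
    (memᵒ I i n ∨ memᵒ J i n) ∧ memᵒ I i n   ≡⟨ ∧-comm _ (memᵒ I i n) ⟩
    memᵒ I i n ∧ (memᵒ I i n ∨ memᵒ J i n)   ≡⟨ ∧-abs-∨ _ _ ⟩
    memᵒ I i n                               ∎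
    where open ≡-Reasoning

  ∩-absorbʳ : ∀ (I J : Obj r) → (I ∪ J) ∩ J ≡ J
  ∩-absorbʳ I J = obj-ext _ _ λ i n → begin
    memᵒ ((I ∪ J) ∩ J) i n                   ≡⟨ memᵒ-∩ (I ∪ J) J i n ⟩
    memᵒ (I ∪ J) i n ∧ memᵒ J i n            ≡⟨ cong (_∧ memᵒ J i n) (memᵒ-∪ I J i n) ⟩
    (memᵒ I i n ∨ memᵒ J i n) ∧ memᵒ J i n   ≡⟨ ∧-comm _ (memᵒ J i n) ⟩
    memᵒ J i n ∧ (memᵒ I i n ∨ memᵒ J i n)   ≡⟨ cong (memᵒ J i n ∧_) (∨-comm (memᵒ I i n) _) ⟩
    memᵒ J i n ∧ (memᵒ J i n ∨ memᵒ I i n)   ≡⟨ ∧-abs-∨ _ _ ⟩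
    memᵒ J i n                               ∎
    where open ≡-Reasoning

disjoint-if-∩≡∅ : ∀ {r} (A B : Obj r) → A ∩ B ≡ ∅ₒ → Disjoint A B
disjoint-if-∩≡∅ []      []      _      = tt
disjoint-if-∩≡∅ (s ∷ A) (t ∷ B) A∩B≡∅
  with s ∩ˢ t | cong head A∩B≡∅ | disjoint-if-∩≡∅ A B (cong tail A∩B≡∅)
... | .∅ˢ | refl | disjoint = disjoint

-- Disjoint copies.  Shifting every element of s up by the length of its
-- bit string gives an isomorphic finite set disjoint from s.

shift : FinSet → FinSet
shift = consˢ false

shift-↔ : ∀ s → Elem s ↔ Elem (shift s)
shift-↔ ∅ˢ     = ↔-id _
shift-↔ (nz s) = mk↔ₛ′ up down up-down down-up
  where
  up : Elem (nz s) → Elem (shift (nz s))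
  up (n , member) = suc n , member
  down : Elem (shift (nz s)) → Elem (nz s)
  down (suc n , member) = n , member
  up-down : ∀ e → up (down e) ≡ e
  up-down (suc n , member) = refl
  down-up : ∀ e → down (up e) ≡ e
  down-up e = refl

shifts : ℕ → FinSet → FinSet
shifts zero    s = s
shifts (suc k) s = shift (shifts k s)

shifts-↔ : ∀ k s → Elem s ↔ Elem (shifts k s)
shifts-↔ zero    s = ↔-id _
shifts-↔ (suc k) s = shift-↔ (shifts k s) ↔-∘ shifts-↔ k s

shifts-above : ∀ k s n → memberᵇ n (toBits (shifts k s)) ≡ true → k ≤ n
shifts-above zero    s n       _      = z≤n
shifts-above (suc k) s zero    member
  with () ← trans (sym (member-consˢ zero false (shifts k s))) member
shifts-above (suc k) s (suc n) member =
  s≤s (shifts-above k s n (trans (sym (member-consˢ (suc n) false (shifts k s))) member))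

member-below-length : ∀ n l → memberᵇ n l ≡ true → n < length l
member-below-length zero    (b ∷ l) _      = s≤s z≤n
member-below-length (suc n) (b ∷ l) member = s≤s (member-below-length n l member)

copy : FinSet → FinSet
copy s = shifts (length (toBits s)) s

copy-disjoint : ∀ s n → (memberᵇ n (toBits s) ∧ memberᵇ n (toBits (copy s))) ≡ false
copy-disjoint s n with memberᵇ n (toBits s) in member | memberᵇ n (toBits (copy s)) in member′
... | false | _     = refl
... | true  | false = refl
... | true  | true  =
  contradiction (shifts-above _ s n member′) (<⇒≱ (member-below-length n (toBits s) member))

copyᵒ : ∀ {r} → Obj r → Obj r
copyᵒ = Vec.map copy

copy-hom : ∀ {r} (A : Obj r) → Hom A (copyᵒ A)
copy-hom A = hom λ i →
  subst (λ t → Elem (lookup A i) ⤖ Elem t) (sym (lookup-map i copy A))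
        (↔⇒⤖ (shifts-↔ (length (toBits (lookup A i))) (lookup A i)))

∩-copy : ∀ {r} (A : Obj r) → A ∩ copyᵒ A ≡ ∅ₒ
∩-copy A = obj-ext _ _ λ i n → begin
  memᵒ (A ∩ copyᵒ A) i n                              ≡⟨ memᵒ-∩ A (copyᵒ A) i n ⟩
  memᵒ A i n ∧ memᵒ (copyᵒ A) i n                     ≡⟨ cong (λ t → memᵒ A i n ∧ memberᵇ n (toBits t))
                                                              (lookup-map i copy A) ⟩
  memᵒ A i n ∧ memberᵇ n (toBits (copy (lookup A i))) ≡⟨ copy-disjoint (lookup A i) n ⟩
  false                                               ≡⟨ memᵒ-∅ i n ⟨
  memᵒ ∅ₒ i n                                         ∎
  where open ≡-Reasoning

Fin-injective⇒onto : ∀ {n} (f : Fin n → Fin n) → Injective _≡_ _≡_ f →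
                     ∀ y → Σ (Fin n) (λ a → f a ≡ y)
Fin-injective⇒onto {suc m} f f-injective y with any? (λ a → f a ≟ y)
... | yes hit = hit
... | no miss = contradiction (injective⇒≤ squeeze-injective) 1+n≰n
  where
  -- if y were missed, f would inject Fin (suc m) into Fin m
  squeeze : Fin (suc m) → Fin m
  squeeze a = punchOut {i = y} {j = f a} (λ y≡fa → miss (a , sym y≡fa))
  squeeze-injective : Injective _≡_ _≡_ squeeze
  squeeze-injective eq =
    f-injective (punchOut-injective (λ y≡fa → miss (_ , sym y≡fa)) (λ y≡fb → miss (_ , sym y≡fb)) eq)

injective⇒onto : ∀ {A : Set} {n} → A ↔ Fin n → (φ : A → A) → Injective _≡_ _≡_ φ →
                 ∀ y → Σ A (λ a → φ a ≡ y)
injective⇒onto A↔Fin φ φ-injective y = from (proj₁ preimage) , to-injective (proj₂ preimage)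
  where
  open Inverse A↔Fin using (to; from; strictlyInverseˡ; strictlyInverseʳ)
  to-injective : Injective _≡_ _≡_ to
  to-injective {a} {b} eq = trans (sym (strictlyInverseʳ a)) (trans (cong from eq) (strictlyInverseʳ b))
  from-injective : Injective _≡_ _≡_ from
  from-injective {a} {b} eq = trans (sym (strictlyInverseˡ a)) (trans (cong to eq) (strictlyInverseˡ b))
  conjugate-injective : Injective _≡_ _≡_ (to ∘ φ ∘ from)
  conjugate-injective = from-injective ∘ φ-injective ∘ to-injective
  preimage : Σ (Fin _) (λ a → to (φ (from a)) ≡ to y)
  preimage = Fin-injective⇒onto (to ∘ φ ∘ from) conjugate-injective (to y)

module Decomposition {r : ℕ} (F : Species r) (C : CompositionOperator F) where
  open Species F
  open CompositionOperator C

  Reducible : (Ω : Obj r) → F₀ Ω → Set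
  Reducible Ω y = Σ[ I ∈ Obj r ] Σ[ J ∈ Obj r ] ¬ (I ≡ ∅ₒ) × ¬ (J ≡ ∅ₒ) × InImg F η I J Ω y

  factors-unique : ∀ {A B Ω a a′ b b′ x} →
                   IsEta F η A B Ω a b x → IsEta F η A B Ω a′ b′ x → (a ≡ a′) × (b ≡ b′)
  factors-unique {A} {B} (d , refl , refl) (d′ , refl , a′⋆b′≡a⋆b)
    rewrite T-irrelevant d′ d = injective A B d _ _ _ _ (sym a′⋆b′≡a⋆b)

  restrict : ∀ {Ω Ω₁ Ω₂ I J a b x} → IsEta F η Ω₁ Ω₂ Ω a b x → InImg F η I J Ω x →
             InImg F η (Ω₁ ∩ I) (Ω₁ ∩ J) Ω₁ a
  restrict {Ω} {Ω₁} {Ω₂} {I} {J} {a} {b} {x}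
           x≡a⋆b@(d , Ω₁∪Ω₂≡Ω , _) x∈I⋆J@(_ , _ , dIJ , I∪J≡Ω , _)
    with y , _ , y-splits , _ , x≡y⋆z
           ← proj₁ (D1 Ω Ω₁ Ω₂ I J d Ω₁∪Ω₂≡Ω dIJ I∪J≡Ω x) ((a , b , x≡a⋆b) , x∈I⋆J)
    = subst (InImg F η (Ω₁ ∩ I) (Ω₁ ∩ J) Ω₁) (sym (proj₁ (factors-unique x≡a⋆b x≡y⋆z))) y-splits

  extend : ∀ {Ω Ω₁ Ω₂ I J a b x} → IsEta F η Ω₁ Ω₂ Ω a b x → Disjoint I J → I ∪ J ≡ Ω →
           InImg F η (Ω₁ ∩ I) (Ω₁ ∩ J) Ω₁ a → InImg F η (Ω₂ ∩ I) (Ω₂ ∩ J) Ω₂ b →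
           InImg F η I J Ω x
  extend {Ω} {Ω₁} {Ω₂} {I} {J} {a} {b} {x}
         x≡a⋆b@(d , Ω₁∪Ω₂≡Ω , _) dIJ I∪J≡Ω a-splits b-splits =
    proj₂ (proj₂ (D1 Ω Ω₁ Ω₂ I J d Ω₁∪Ω₂≡Ω dIJ I∪J≡Ω x) (a , b , a-splits , b-splits , x≡a⋆b))

  to-traces : ∀ {I J Ω y} → I ∪ J ≡ Ω → InImg F η I J Ω y → InImg F η (Ω ∩ I) (Ω ∩ J) Ω y
  to-traces {I} {J} {y = y} refl = subst₂ (λ P Q → InImg F η P Q (I ∪ J) y) (sym (∩-absorbˡ I J)) (sym (∩-absorbʳ I J))

  from-traces : ∀ {I J Ω y} → I ∪ J ≡ Ω → InImg F η (Ω ∩ I) (Ω ∩ J) Ω y → InImg F η I J Ω y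
  from-traces {I} {J} {y = y} refl = subst₂ (λ P Q → InImg F η P Q (I ∪ J) y) (∩-absorbˡ I J) (∩-absorbʳ I J)

  -- Multiplying an irreducible element by anything over the empty set keeps it
  -- irreducible: a splitting of the product restricts to one of the factor.
  irreducible-product : ∀ {Ω₁ Ω₂ Ω a b x} → Ω₁ ≡ Ω → IsEta F η Ω₁ Ω₂ Ω a b x →
                        InFη F η Ω₁ a → InFη F η Ω x
  irreducible-product {Ω₁} {a = a} {x = x} refl x≡a⋆b (Ω≢∅ , a-irreducible) = Ω≢∅ , x-irreducible
    where
    x-irreducible : ¬ Reducible Ω₁ x
    x-irreducible (I , J , I≢∅ , J≢∅ , x∈I⋆J@(_ , _ , _ , I∪J≡Ω , _)) =
      a-irreducible (I , J , I≢∅ , J≢∅ , from-traces I∪J≡Ω (restrict x≡a⋆b x∈I⋆J))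

  -- Decomposability makes F[∅] inhabited: glue a₀ to its transport onto a
  -- disjoint copy of A, then restrict along that same splitting.
  empty-element : Σ[ A ∈ Obj r ] F₀ A → F₀ ∅ₒ
  empty-element (A , a₀) = subst F₀ (∩-copy A) (proj₁ (proj₂ (restrict glued (a₀ , b₀ , glued))))
    where
    disjoint : Disjoint A (copyᵒ A)
    disjoint = disjoint-if-∩≡∅ A (copyᵒ A) (∩-copy A)
    b₀ : F₀ (copyᵒ A)
    b₀ = F₁ (copy-hom A) a₀
    glued : IsEta F η A (copyᵒ A) (A ∪ copyᵒ A) a₀ b₀ (η A (copyᵒ A) disjoint a₀ b₀)
    glued = disjoint , refl , refl

  universal-unit : F₀ ∅ₒ → (Z : Obj r) → Z ≡ ∅ₒ →
                   Σ[ u ∈ F₀ Z ] (∀ I J → InImg F η (Z ∩ I) (Z ∩ J) Z u)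
  universal-unit e _ refl = u , λ I J →
    subst₂ (λ P Q → InImg F η P Q ∅ₒ u) (sym (∩-zeroˡ I)) (sym (∩-zeroˡ J)) (e , e , d , ∅∪∅ , refl)
    where
    d : Disjoint (∅ₒ {r}) ∅ₒ
    d = disjoint-if-∩≡∅ (∅ₒ {r}) ∅ₒ (∩-zeroʳ ∅ₒ)
    ∅∪∅ : (∅ₒ {r}) ∪ ∅ₒ ≡ ∅ₒ
    ∅∪∅ = ∪-identityʳ ∅ₒ
    u : F₀ ∅ₒ
    u = subst F₀ ∅∪∅ (η ∅ₒ ∅ₒ d e e)

  -- For u ∈ F[Z] with Z empty, a ↦ a ⋆ u is injective on the finite set
  -- F[Ω] (η is injective), hence onto: every x factors as a ⋆ u.
  factor-through : ∀ {Ω Z} (d : Disjoint Ω Z) (e : Ω ∪ Z ≡ Ω) (u : F₀ Z) (x : F₀ Ω) →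
                   Σ[ a ∈ F₀ Ω ] IsEta F η Ω Z Ω a u x
  factor-through {Ω} {Z} d e u x = proj₁ preimage , d , e , proj₂ preimage
    where
    times-u : F₀ Ω → F₀ Ω
    times-u a = subst F₀ e (η Ω Z d a u)
    times-u-injective : Injective _≡_ _≡_ times-u
    times-u-injective eq = proj₁ (factors-unique (d , e , refl) (d , e , sym eq))
    preimage : Σ[ a ∈ F₀ Ω ] times-u a ≡ x
    preimage = injective⇒onto (proj₂ (finite Ω)) times-u times-u-injective x

  F¹⊆Fη : ∀ Ω x → InFη¹ F η Ω x → InFη F η Ω x
  F¹⊆Fη Ω x (Ω₁ , _ , a , b , a-irreducible , rest≡∅ , x≡a⋆b@(_ , Ω₁∪rest≡Ω , _)) =
    irreducible-product Ω₁≡Ω x≡a⋆b a-irreducible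
    where
    Ω₁≡Ω : Ω₁ ≡ Ω
    Ω₁≡Ω = begin
      Ω₁             ≡⟨ ∪-identityʳ Ω₁ ⟨
      Ω₁ ∪ ∅ₒ        ≡⟨ cong (Ω₁ ∪_) rest≡∅ ⟨
      Ω₁ ∪ (Ω - Ω₁)  ≡⟨ Ω₁∪rest≡Ω ⟩
      Ω              ∎
      where open ≡-Reasoning

  -- F_η[Ω] ⊆ F^(1)_η[Ω]: write x = a ⋆ u with u the universal unit; a
  -- splitting of a would extend to one of x.
  Fη⊆F¹ : Σ[ A ∈ Obj r ] F₀ A → ∀ Ω x → InFη F η Ω x → InFη¹ F η Ω x
  Fη⊆F¹ nonempty Ω x (Ω≢∅ , x-irreducible) =
    Ω , (λ _ _ member → member) , a , u , (Ω≢∅ , a-irreducible) , ∖-self Ω , x≡a⋆u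
    where
    unit : Σ[ u ∈ F₀ (Ω - Ω) ] (∀ I J → InImg F η ((Ω - Ω) ∩ I) ((Ω - Ω) ∩ J) (Ω - Ω) u)
    unit = universal-unit (empty-element nonempty) (Ω - Ω) (∖-self Ω)
    u : F₀ (Ω - Ω)
    u = proj₁ unit
    disjoint : Disjoint Ω (Ω - Ω)
    disjoint = disjoint-if-∩≡∅ Ω (Ω - Ω) (trans (cong (Ω ∩_) (∖-self Ω)) (∩-zeroʳ Ω))
    Ω∪∅≡Ω : Ω ∪ (Ω - Ω) ≡ Ω
    Ω∪∅≡Ω = trans (cong (Ω ∪_) (∖-self Ω)) (∪-identityʳ Ω)
    factorisation : Σ[ a ∈ F₀ Ω ] IsEta F η Ω (Ω - Ω) Ω a u x
    factorisation = factor-through disjoint Ω∪∅≡Ω u x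
    a : F₀ Ω
    a = proj₁ factorisation
    x≡a⋆u : IsEta F η Ω (Ω - Ω) Ω a u x
    x≡a⋆u = proj₂ factorisation
    a-irreducible : ¬ Reducible Ω a
    a-irreducible (I , J , I≢∅ , J≢∅ , a∈I⋆J@(_ , _ , dIJ , I∪J≡Ω , _)) =
      x-irreducible (I , J , I≢∅ , J≢∅ ,
        extend x≡a⋆u dIJ I∪J≡Ω (to-traces I∪J≡Ω a∈I⋆J) (proj₂ unit I J))

-- Lemma 5.3.  The two inclusions above.
lemma5p3 : (r : ℕ) → 0 < r → (F : Species r) →
    (nonempty : Σ[ A ∈ Obj r ] Species.F₀ F A) → (C : CompositionOperator F) →
    ∀ (Ω : Obj r) (x : Species.F₀ F Ω) →
    InFη¹ F (CompositionOperator.η C) Ω x ⇔ InFη F (CompositionOperator.η C) Ω x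
lemma5p3 r _ F nonempty C Ω x =
  mk⇔ (F¹⊆Fη Ω x) (Fη⊆F¹ nonempty Ω x)
  where open Decomposition F C
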